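{- Let $S\le T$ and $S'\le T'$ be pairs of subsets of $[n]$ in the type $C_n$ Gale order. Then $P(\Delta[S,T])\cap P(\Delta[S',T'])$ is either empty or equal to $P(\Delta[C,D])$ for some subsets $C\le D$ of $[n]$.
   Context: Type $C_n$ Gale order on subsets of $[n]$: for $A=\{a_1<\dots<a_j\}$, $B=\{b_1<\dots<b_k\}$, $A\le B$ iff $j\le k$ and $a_{j-i+1}\le b_{k-i+1}$ for all $i\in[j]$. For $S\le T$, $\Delta[S,T]$ is the delta matroid on $[n]$ whose feasible sets are all $R$ with $S\le R\le T$, and $P(\Delta[S,T])=\operatorname{conv}\{e_R: R\text{ feasible}\}\subseteq\mathbb{R}^n$, $e_R=\sum_{i\in R}e_i$.
   Formalization: The polytopes $P(\Delta[S,T])$ are taken in ℚ^n instead of $\mathbb{R}^n$: their points have rational coordinates and their convex coefficients are rational. -}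

module Defs where

open import Data.Nat using (ℕ)
open import Data.Fin using (Fin)
import Data.Fin as F
open import Data.Fin.Subset using (Subset; Side; inside; outside)
open import Data.Vec using (lookup)
open import Data.List using (List; []; _∷_; map; reverse; allFin; foldr)
open import Data.List.Relation.Unary.All using (All)
open import Data.Product using (Σ; ∃; _×_; _,_; proj₁)
open import Data.Rational using (ℚ; 0ℚ; 1ℚ; _≤_; _*_)
import Data.Rational as Q

sumℚ : List ℚ → ℚ
sumℚ = foldr Q._+_ 0ℚ
open import Relation.Binary.PropositionalEquality using (_≡_)

elemsDesc : ∀ {n} → Subset n → List (Fin n)
elemsDesc {n} A = go (reverse (allFin n))
  where
  go : List (Fin n) → List (Fin n)
  go [] = []
  go (i ∷ is) with lookup A i
  ... | inside  = i ∷ go is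
  ... | outside = go is

data _≼_ {n : ℕ} : List (Fin n) → List (Fin n) → Set where
  []≼  : ∀ {bs} → [] ≼ bs
  ∷≼   : ∀ {a b as bs} → a F.≤ b → as ≼ bs → (a ∷ as) ≼ (b ∷ bs)

-- Type C_n Gale order on subsets of [n]:
-- A ≤ B iff |A| ≤ |B| and the i-th largest element of A is ≤ the
-- i-th largest element of B, for all i ∈ [|A|].
_≤G_ : ∀ {n} → Subset n → Subset n → Set
A ≤G B = elemsDesc A ≼ elemsDesc B

Feasible : ∀ {n} → Subset n → Subset n → Subset n → Set
Feasible S T R = (S ≤G R) × (R ≤G T)

e : ∀ {n} → Subset n → Fin n → ℚ
e R i with lookup R i
... | inside  = 1ℚ
... | outside = 0ℚ

Point : ℕ → Set
Point n = Fin n → ℚ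

InConv : ∀ {n} → (Subset n → Set) → Point n → Set
InConv {n} F x =
  Σ (List (ℚ × Subset n)) λ L →
    All (λ cR → (0ℚ ≤ proj₁ cR) × F (Data.Product.proj₂ cR)) L
    × sumℚ (map proj₁ L) ≡ 1ℚ
    × (∀ i → x i ≡ sumℚ (map (λ cR → proj₁ cR * e (Data.Product.proj₂ cR) i) L))

-- P(Δ[S,T]) (its rational points)
P : ∀ {n} → Subset n → Subset n → Point n → Set
P S T = InConv (Feasible S T)

-- Write c_A(t) = |A ∩ {t, …, n-1}|. The Gale order is A ≤ B iff c_A ≤ c_B pointwise, and the
-- functions c_A are exactly the lattice paths: antitone, with steps of size at most 1, and
-- vanishing from n on. Consequently P(Δ[C,D]) is the set of x ∈ [0,1]ⁿ with
-- c_C(t) ≤ Σ_{j≥t} x_j ≤ c_D(t) for all t. One inclusion is linearity. For the other, clear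
-- denominators, N·x = X ∈ ℕⁿ, and round the path Y(t) = Σ_{j≥t} X_j (steps ≤ N) to the N
-- lattice paths ⌊(Y(t) + k)/N⌋, k < N; by Hermite's identity x is the average of their
-- indicator vectors. Pointwise max and min of lattice paths are lattice paths, so
-- P(Δ[S,T]) ∩ P(Δ[S′,T′]) = P(Δ[C,D]) for the sets with c_C = max(c_S, c_S′) and
-- c_D = min(c_T, c_T′), and the intersection is empty if C ≰ D.

module Submission where

open import Defs
open import Data.Bool using (true; false; if_then_else_)
open import Data.Fin as F using (Fin; toℕ) renaming (zero to fzero; suc to fsuc)
import Data.Fin.Properties as FP
open import Data.Fin.Subset using (Subset; Side; inside; outside)
open import Data.Integer as ℤ using (-[1+_])
import Data.Integer.Properties as ℤ
open import Data.List using (List; []; _∷_; _++_; [_]; _∷ʳ_; map; length; filter; filterᵇ; reverse; allFin; tabulate)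
import Data.List.Properties as LP
open import Data.List.Relation.Unary.All as All using (All; []; _∷_)
import Data.List.Relation.Unary.All.Properties as All
open import Data.List.Relation.Unary.AllPairs as AllPairs using (AllPairs; []; _∷_)
import Data.List.Relation.Unary.AllPairs.Properties as AllPairs
open import Data.Nat using (ℕ; zero; suc; _+_; _*_; _⊔_; _⊓_; _≤_; _<_; _≤?_; _<ᵇ_; z≤n; s≤s; NonZero)
open import Data.Nat.DivMod using (_/_; /-monoˡ-≤; m<n⇒m/n≡0; +-distrib-/-∣ˡ; n/n≡1; m*n/n≡m; m<n*o⇒m/o<n)
open import Data.Nat.Divisibility using (∣-refl)
import Data.Nat.Properties as ℕ
open import Algebra.Properties.CommutativeMonoid.Sum ℕ.+-0-commutativeMonoid
  using (sum-syntax; ∑-distrib-+; sum-cong-≗; sum-init-last; sum-replicate-zero)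
open import Data.Product using (Σ; _×_; _,_; proj₁; proj₂)
open import Data.Rational as ℚ using (ℚ; mkℚ; 0ℚ; 1ℚ; 1/_; *≤*)
  renaming (_+_ to _+ℚ_; _*_ to _*ℚ_; _≤_ to _≤ℚ_)
open import Data.Rational.Literals using (fromℤ)
import Data.Rational.Properties as ℚ
open import Data.Rational.Solver using (module +-*-Solver)
import Data.Rational.Unnormalised as ℚᵘ
import Data.Rational.Unnormalised.Properties as ℚᵘ
open import Data.Sum using (_⊎_; inj₁; inj₂)
open import Data.Vec using ([]; _∷_; lookup)
open import Function using (_∘_; id)
open import Function.Bundles using (_⇔_; mk⇔; Equivalence)
open import Relation.Binary.PropositionalEquality
  using (_≡_; refl; sym; trans; cong; cong₂; subst; subst₂; module ≡-Reasoning)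
open import Relation.Nullary using (Dec; yes; no; ¬_; ofʸ; ofⁿ)

-- Gale order via tail counts

-- elemsDesc filters through a where-bound function of Defs that cannot be named here, so the
-- statement of go≡filter is left to unification.
mutual
  elemsDesc≡filter : ∀ {n} (A : Subset n) → elemsDesc A ≡ filterᵇ (lookup A) (reverse (allFin n))
  elemsDesc≡filter {n} A with reverse (allFin n)
  ... | is = go≡filter A is

  go≡filter : ∀ {n} (A : Subset n) (is : List (Fin n)) → _
  go≡filter A []       = refl
  go≡filter A (i ∷ is) with lookup A i
  ... | inside  = cong (i ∷_) (go≡filter A is)
  ... | outside = go≡filter A is

reverse-allFin-suc : ∀ n → reverse (allFin (suc n)) ≡ map fsuc (reverse (allFin n)) ∷ʳ fzero
reverse-allFin-suc n = begin
  reverse (fzero ∷ tabulate fsuc)          ≡⟨ LP.unfold-reverse fzero (tabulate fsuc) ⟩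
  reverse (tabulate fsuc) ∷ʳ fzero         ≡⟨ cong (λ is → reverse is ∷ʳ fzero) (LP.map-tabulate id fsuc) ⟨
  reverse (map fsuc (allFin n)) ∷ʳ fzero   ≡⟨ cong (_∷ʳ fzero) (LP.reverse-map fsuc (allFin n)) ⟨
  map fsuc (reverse (allFin n)) ∷ʳ fzero   ∎
  where open ≡-Reasoning

filterᵇ-map-suc : ∀ {n} b (A : Subset n) is →
  filterᵇ (lookup (b ∷ A)) (map fsuc is) ≡ map fsuc (filterᵇ (lookup A) is)
filterᵇ-map-suc b A []       = refl
filterᵇ-map-suc b A (i ∷ is) with lookup A i
... | inside  = cong (fsuc i ∷_) (filterᵇ-map-suc b A is)
... | outside = filterᵇ-map-suc b A is

zeroIf : ∀ {n} → Side → List (Fin (suc n))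
zeroIf b = if b then [ fzero ] else []

elemsDesc-∷ : ∀ {n} b (A : Subset n) → elemsDesc (b ∷ A) ≡ map fsuc (elemsDesc A) ++ zeroIf b
elemsDesc-∷ {n} b A = begin
  elemsDesc (b ∷ A)
    ≡⟨ elemsDesc≡filter (b ∷ A) ⟩
  filterᵇ (lookup (b ∷ A)) (reverse (allFin (suc n)))
    ≡⟨ cong (filterᵇ (lookup (b ∷ A))) (reverse-allFin-suc n) ⟩
  filterᵇ (lookup (b ∷ A)) (map fsuc (reverse (allFin n)) ++ [ fzero ])
    ≡⟨ LP.filter-++ _ (map fsuc (reverse (allFin n))) [ fzero ] ⟩
  filterᵇ (lookup (b ∷ A)) (map fsuc (reverse (allFin n))) ++ filterᵇ (lookup (b ∷ A)) [ fzero ]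
    ≡⟨ cong₂ _++_ (filterᵇ-map-suc b A (reverse (allFin n))) (filterᵇ-zero b) ⟩
  map fsuc (filterᵇ (lookup A) (reverse (allFin n))) ++ zeroIf b
    ≡⟨ cong (λ is → map fsuc is ++ zeroIf b) (elemsDesc≡filter A) ⟨
  map fsuc (elemsDesc A) ++ zeroIf b
    ∎
  where
  open ≡-Reasoning
  filterᵇ-zero : ∀ b → filterᵇ (lookup (b ∷ A)) [ fzero ] ≡ zeroIf b
  filterᵇ-zero inside  = refl
  filterᵇ-zero outside = refl

Descending : ∀ {n} → List (Fin n) → Set
Descending = AllPairs F._>_

elemsDesc-descending : ∀ {n} (A : Subset n) → Descending (elemsDesc A)
elemsDesc-descending []      = []
elemsDesc-descending {suc n} (b ∷ A) rewrite elemsDesc-∷ b A =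
  AllPairs.++⁺ (AllPairs.map⁺ (AllPairs.map s≤s (elemsDesc-descending A))) (zeroIf-descending b)
    (All.map⁺ (All.universal (λ _ → above-zeroIf b) (elemsDesc A)))
  where
  zeroIf-descending : ∀ b → Descending (zeroIf {n} b)
  zeroIf-descending inside  = [] ∷ []
  zeroIf-descending outside = []
  above-zeroIf : ∀ b {i : Fin n} → All (fsuc i F.>_) (zeroIf b)
  above-zeroIf inside  = s≤s z≤n ∷ []
  above-zeroIf outside = []

eℕ : ∀ {n} → Subset n → Fin n → ℕ
eℕ A j = if lookup A j then 1 else 0

suffixSum : ∀ {A : Set} → (A → A → A) → A → ∀ {n} → (Fin n → A) → ℕ → A
suffixSum _∙_ ε {zero}  x t       = ε
suffixSum _∙_ ε {suc n} x zero    = x fzero ∙ suffixSum _∙_ ε (x ∘ fsuc) zero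
suffixSum _∙_ ε {suc n} x (suc t) = suffixSum _∙_ ε (x ∘ fsuc) t

suffixSum-cong : ∀ {A : Set} {_∙_ : A → A → A} {ε : A} {n} {x y : Fin n → A} →
  (∀ j → x j ≡ y j) → ∀ t → suffixSum _∙_ ε x t ≡ suffixSum _∙_ ε y t
suffixSum-cong {n = zero}               x≡y t       = refl
suffixSum-cong {_∙_ = _∙_} {n = suc n} x≡y zero    = cong₂ _∙_ (x≡y fzero) (suffixSum-cong (x≡y ∘ fsuc) zero)
suffixSum-cong {n = suc n}              x≡y (suc t) = suffixSum-cong (x≡y ∘ fsuc) t

suffixSum-homo : ∀ {A B : Set} {_∙_ : A → A → A} {ε : A} {_◦_ : B → B → B} {ε′ : B} (f : A → B) →
  f ε ≡ ε′ → (∀ a b → f (a ∙ b) ≡ f a ◦ f b) →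
  ∀ {n} (x : Fin n → A) t → f (suffixSum _∙_ ε x t) ≡ suffixSum _◦_ ε′ (f ∘ x) t
suffixSum-homo f f-ε f-∙ {zero}  x t = f-ε
suffixSum-homo {_◦_ = _◦_} f f-ε f-∙ {suc n} x zero =
  trans (f-∙ (x fzero) _) (cong (f (x fzero) ◦_) (suffixSum-homo f f-ε f-∙ (x ∘ fsuc) zero))
suffixSum-homo f f-ε f-∙ {suc n} x (suc t) = suffixSum-homo f f-ε f-∙ (x ∘ fsuc) t

suffixSum-split : ∀ {A : Set} {_∙_ : A → A → A} {ε : A} {n} (x : Fin n → A) j →
  suffixSum _∙_ ε x (toℕ j) ≡ x j ∙ suffixSum _∙_ ε x (suc (toℕ j))
suffixSum-split x fzero    = refl
suffixSum-split x (fsuc j) = suffixSum-split (x ∘ fsuc) j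

Σ≥ : ∀ {n} → (Fin n → ℕ) → ℕ → ℕ
Σ≥ = suffixSum _+_ 0

-- count≥ A t is c_A(t); the elements of Fin n stand for 0, …, n-1.
count≥ : ∀ {n} → Subset n → ℕ → ℕ
count≥ A = Σ≥ (eℕ A)

count≥ˡ : ∀ {n} → ℕ → List (Fin n) → ℕ
count≥ˡ t = length ∘ filter (λ i → t ≤? toℕ i)

count≥ˡ-++ : ∀ {n} t (xs ys : List (Fin n)) → count≥ˡ t (xs ++ ys) ≡ count≥ˡ t xs + count≥ˡ t ys
count≥ˡ-++ t xs ys = trans (cong length (LP.filter-++ _ xs ys)) (LP.length-++ (filter _ xs))

count≥ˡ-zero : ∀ {n} (xs : List (Fin n)) → count≥ˡ 0 xs ≡ length xs
count≥ˡ-zero xs = cong length (LP.filter-all _ (All.universal (λ _ → z≤n) xs))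

count≥ˡ-accept : ∀ {n t} (i : Fin n) is → t ≤ toℕ i → count≥ˡ t (i ∷ is) ≡ suc (count≥ˡ t is)
count≥ˡ-accept _ _ t≤i = cong length (LP.filter-accept (λ i → _ ≤? toℕ i) t≤i)

count≥ˡ-reject : ∀ {n t} (i : Fin n) is → ¬ t ≤ toℕ i → count≥ˡ t (i ∷ is) ≡ count≥ˡ t is
count≥ˡ-reject _ _ t≰i = cong length (LP.filter-reject (λ i → _ ≤? toℕ i) t≰i)

count≥ˡ-vanish : ∀ {n t} {xs : List (Fin n)} → All (λ i → toℕ i < t) xs → count≥ˡ t xs ≡ 0
count≥ˡ-vanish below = cong length (LP.filter-none _ (All.map ℕ.<⇒≱ below))

count≥ˡ-map-suc : ∀ {n} t (xs : List (Fin n)) → count≥ˡ (suc t) (map fsuc xs) ≡ count≥ˡ t xs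
count≥ˡ-map-suc t []       = refl
count≥ˡ-map-suc t (i ∷ is) with t ≤? toℕ i
... | yes t≤i = begin
  count≥ˡ (suc t) (map fsuc (i ∷ is))   ≡⟨ count≥ˡ-accept (fsuc i) (map fsuc is) (s≤s t≤i) ⟩
  suc (count≥ˡ (suc t) (map fsuc is))   ≡⟨ cong suc (count≥ˡ-map-suc t is) ⟩
  suc (count≥ˡ t is)                    ≡⟨ count≥ˡ-accept i is t≤i ⟨
  count≥ˡ t (i ∷ is)                    ∎
  where open ≡-Reasoning
... | no t≰i = begin
  count≥ˡ (suc t) (map fsuc (i ∷ is))   ≡⟨ count≥ˡ-reject (fsuc i) (map fsuc is) (t≰i ∘ ℕ.≤-pred) ⟩
  count≥ˡ (suc t) (map fsuc is)         ≡⟨ count≥ˡ-map-suc t is ⟩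
  count≥ˡ t is                          ≡⟨ count≥ˡ-reject i is t≰i ⟨
  count≥ˡ t (i ∷ is)                    ∎
  where open ≡-Reasoning

count≥ˡ-beyond-head : ∀ {n t} {a : Fin n} {as} → Descending (a ∷ as) → toℕ a < t →
  count≥ˡ t (a ∷ as) ≡ 0
count≥ˡ-beyond-head (a>as ∷ _) a<t = count≥ˡ-vanish (a<t ∷ All.map (λ i<a → ℕ.<-trans i<a a<t) a>as)

count≥-elemsDesc : ∀ {n} (A : Subset n) t → count≥ A t ≡ count≥ˡ t (elemsDesc A)
count≥-elemsDesc []      t       = refl
count≥-elemsDesc (b ∷ A) zero    = begin
  eℕ (b ∷ A) fzero + count≥ A 0
    ≡⟨ cong₂ _+_ (zero-count b) (count≥-elemsDesc A 0) ⟩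
  count≥ˡ 0 (zeroIf b) + count≥ˡ 0 (elemsDesc A)
    ≡⟨ cong (count≥ˡ 0 (zeroIf b) +_) shift ⟨
  count≥ˡ 0 (zeroIf b) + count≥ˡ 0 (map fsuc (elemsDesc A))
    ≡⟨ ℕ.+-comm (count≥ˡ 0 (zeroIf b)) _ ⟩
  count≥ˡ 0 (map fsuc (elemsDesc A)) + count≥ˡ 0 (zeroIf b)
    ≡⟨ count≥ˡ-++ 0 (map fsuc (elemsDesc A)) (zeroIf b) ⟨
  count≥ˡ 0 (map fsuc (elemsDesc A) ++ zeroIf b)
    ≡⟨ cong (count≥ˡ 0) (elemsDesc-∷ b A) ⟨
  count≥ˡ 0 (elemsDesc (b ∷ A))
    ∎
  where
  open ≡-Reasoning
  zero-count : ∀ b → eℕ (b ∷ A) fzero ≡ count≥ˡ 0 (zeroIf b)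
  zero-count inside  = refl
  zero-count outside = refl
  shift : count≥ˡ 0 (map fsuc (elemsDesc A)) ≡ count≥ˡ 0 (elemsDesc A)
  shift = trans (count≥ˡ-zero (map fsuc (elemsDesc A)))
                (trans (LP.length-map fsuc (elemsDesc A)) (sym (count≥ˡ-zero (elemsDesc A))))
count≥-elemsDesc {suc n} (b ∷ A) (suc t) = begin
  count≥ A t
    ≡⟨ count≥-elemsDesc A t ⟩
  count≥ˡ t (elemsDesc A)
    ≡⟨ count≥ˡ-map-suc t (elemsDesc A) ⟨
  count≥ˡ (suc t) (map fsuc (elemsDesc A))
    ≡⟨ ℕ.+-identityʳ _ ⟨
  count≥ˡ (suc t) (map fsuc (elemsDesc A)) + 0
    ≡⟨ cong (_ +_) (zero-count b) ⟨
  count≥ˡ (suc t) (map fsuc (elemsDesc A)) + count≥ˡ (suc t) (zeroIf b)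
    ≡⟨ count≥ˡ-++ (suc t) (map fsuc (elemsDesc A)) (zeroIf b) ⟨
  count≥ˡ (suc t) (map fsuc (elemsDesc A) ++ zeroIf b)
    ≡⟨ cong (count≥ˡ (suc t)) (elemsDesc-∷ b A) ⟨
  count≥ˡ (suc t) (elemsDesc (b ∷ A))
    ∎
  where
  open ≡-Reasoning
  zero-count : ∀ b → count≥ˡ (suc t) (zeroIf {n} b) ≡ 0
  zero-count inside  = refl
  zero-count outside = refl

≼⇒count≥ˡ-≤ : ∀ {n} {as bs : List (Fin n)} → as ≼ bs → Descending as →
  ∀ t → count≥ˡ t as ≤ count≥ˡ t bs
≼⇒count≥ˡ-≤ []≼ _ t = z≤n
≼⇒count≥ˡ-≤ {as = a ∷ as} {b ∷ bs} (∷≼ a≤b as≼bs) as-desc@(_ ∷ as-desc′) t with t ≤? toℕ a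
... | yes t≤a = begin
  count≥ˡ t (a ∷ as)   ≡⟨ count≥ˡ-accept a as t≤a ⟩
  suc (count≥ˡ t as)   ≤⟨ s≤s (≼⇒count≥ˡ-≤ as≼bs as-desc′ t) ⟩
  suc (count≥ˡ t bs)   ≡⟨ count≥ˡ-accept b bs (ℕ.≤-trans t≤a a≤b) ⟨
  count≥ˡ t (b ∷ bs)   ∎
  where open ℕ.≤-Reasoning
... | no t≰a = subst (_≤ count≥ˡ t (b ∷ bs)) (sym (count≥ˡ-beyond-head as-desc (ℕ.≰⇒> t≰a))) z≤n

count≥ˡ-≤⇒≼ : ∀ {n} {as bs : List (Fin n)} → Descending as → Descending bs →
  (∀ t → count≥ˡ t as ≤ count≥ˡ t bs) → as ≼ bs
count≥ˡ-≤⇒≼ {as = []} _ _ _ = []≼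
count≥ˡ-≤⇒≼ {as = a ∷ as} {[]} _ _ as≤bs
  with () ← subst (_≤ 0) (count≥ˡ-accept a as ℕ.≤-refl) (as≤bs (toℕ a))
count≥ˡ-≤⇒≼ {as = a ∷ as} {b ∷ bs} (a>as ∷ as-desc) bs-desc@(_ ∷ bs-desc′) as≤bs =
  ∷≼ a≤b (count≥ˡ-≤⇒≼ as-desc bs-desc′ tails-≤)
  where
  a≤b : a F.≤ b
  a≤b with toℕ a ≤? toℕ b
  ... | yes a≤b = a≤b
  ... | no a≰b
    with () ← subst₂ _≤_ (count≥ˡ-accept a as ℕ.≤-refl) (count≥ˡ-beyond-head bs-desc (ℕ.≰⇒> a≰b))
                         (as≤bs (toℕ a))
  tails-≤ : ∀ t → count≥ˡ t as ≤ count≥ˡ t bs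
  tails-≤ t with t ≤? toℕ a
  ... | yes t≤a = ℕ.≤-pred (subst₂ _≤_ (count≥ˡ-accept a as t≤a) (count≥ˡ-accept b bs (ℕ.≤-trans t≤a a≤b))
                                       (as≤bs t))
  ... | no t≰a  = subst (_≤ count≥ˡ t bs)
                        (sym (count≥ˡ-vanish (All.map (λ i<a → ℕ.<-trans i<a (ℕ.≰⇒> t≰a)) a>as))) z≤n

≤G⇒count≥-≤ : ∀ {n} {A B : Subset n} → A ≤G B → ∀ t → count≥ A t ≤ count≥ B t
≤G⇒count≥-≤ {A = A} {B} A≤B t = subst₂ _≤_ (sym (count≥-elemsDesc A t)) (sym (count≥-elemsDesc B t))
  (≼⇒count≥ˡ-≤ A≤B (elemsDesc-descending A) t)

count≥-≤⇒≤G : ∀ {n} {A B : Subset n} → (∀ t → count≥ A t ≤ count≥ B t) → A ≤G B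
count≥-≤⇒≤G {A = A} {B} A≤B = count≥ˡ-≤⇒≼ (elemsDesc-descending A) (elemsDesc-descending B)
  (λ t → subst₂ _≤_ (count≥-elemsDesc A t) (count≥-elemsDesc B t) (A≤B t))

_≼?_ : ∀ {n} (as bs : List (Fin n)) → Dec (as ≼ bs)
[]       ≼? bs       = yes []≼
(a ∷ as) ≼? []       = no λ ()
(a ∷ as) ≼? (b ∷ bs) with a F.≤? b | as ≼? bs
... | yes a≤b | yes as≼bs = yes (∷≼ a≤b as≼bs)
... | no a≰b  | _         = no λ { (∷≼ a≤b _) → a≰b a≤b }
... | _       | no as⋠bs  = no λ { (∷≼ _ as≼bs) → as⋠bs as≼bs }

_≤G?_ : ∀ {n} (A B : Subset n) → Dec (A ≤G B)
A ≤G? B = elemsDesc A ≼? elemsDesc B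

-- Lattice paths

record IsPath (N n : ℕ) (h : ℕ → ℕ) : Set where
  field
    vanishes : ∀ {t} → n ≤ t → h t ≡ 0
    antitone : ∀ t → h (suc t) ≤ h t
    step≤    : ∀ t → h t ≤ N + h (suc t)

open IsPath

IsPath-tail : ∀ {N n h} → IsPath N (suc n) h → IsPath N n (h ∘ suc)
IsPath-tail p = record
  { vanishes = λ n≤t → vanishes p (s≤s n≤t)
  ; antitone = antitone p ∘ suc
  ; step≤    = step≤ p ∘ suc
  }

Σ≥-isPath : ∀ {N n} (X : Fin n → ℕ) → (∀ j → X j ≤ N) → IsPath N n (Σ≥ X)
Σ≥-isPath {n = zero}    X X≤N =
  record { vanishes = λ _ → refl ; antitone = λ _ → z≤n ; step≤ = λ _ → z≤n }
Σ≥-isPath {N} {suc n}  X X≤N = record { vanishes = vanishes′ ; antitone = antitone′ ; step≤ = step≤′ }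
  where
  tail : IsPath N n (Σ≥ (X ∘ fsuc))
  tail = Σ≥-isPath (X ∘ fsuc) (X≤N ∘ fsuc)
  vanishes′ : ∀ {t} → suc n ≤ t → Σ≥ X t ≡ 0
  vanishes′ (s≤s n≤t) = vanishes tail n≤t
  antitone′ : ∀ t → Σ≥ X (suc t) ≤ Σ≥ X t
  antitone′ zero    = ℕ.m≤n+m _ (X fzero)
  antitone′ (suc t) = antitone tail t
  step≤′ : ∀ t → Σ≥ X t ≤ N + Σ≥ X (suc t)
  step≤′ zero    = ℕ.+-monoˡ-≤ _ (X≤N fzero)
  step≤′ (suc t) = step≤ tail t

eℕ≤1 : ∀ {n} (A : Subset n) j → eℕ A j ≤ 1
eℕ≤1 A j with lookup A j
... | inside  = ℕ.≤-refl
... | outside = z≤n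

count≥-isPath : ∀ {n} (A : Subset n) → IsPath 1 n (count≥ A)
count≥-isPath A = Σ≥-isPath (eℕ A) (eℕ≤1 A)

⊔-isPath : ∀ {N n f g} → IsPath N n f → IsPath N n g → IsPath N n (λ t → f t ⊔ g t)
⊔-isPath {N} p q = record
  { vanishes = λ n≤t → cong₂ _⊔_ (vanishes p n≤t) (vanishes q n≤t)
  ; antitone = λ t → ℕ.⊔-mono-≤ (antitone p t) (antitone q t)
  ; step≤    = λ t → ℕ.≤-trans (ℕ.⊔-mono-≤ (step≤ p t) (step≤ q t))
                                (ℕ.≤-reflexive (sym (ℕ.+-distribˡ-⊔ N _ _)))
  }

⊓-isPath : ∀ {N n f g} → IsPath N n f → IsPath N n g → IsPath N n (λ t → f t ⊓ g t)
⊓-isPath {N} p q = record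
  { vanishes = λ n≤t → cong₂ _⊓_ (vanishes p n≤t) (vanishes q n≤t)
  ; antitone = λ t → ℕ.⊓-mono-≤ (antitone p t) (antitone q t)
  ; step≤    = λ t → ℕ.≤-trans (ℕ.⊓-mono-≤ (step≤ p t) (step≤ q t))
                                (ℕ.≤-reflexive (sym (ℕ.+-distribˡ-⊓ N _ _)))
  }

fromPath : ∀ {n} → (ℕ → ℕ) → Subset n
fromPath {zero}  h = []
fromPath {suc n} h = (h 1 <ᵇ h 0) ∷ fromPath (h ∘ suc)

unit-step : ∀ {a b} → a ≤ b → b ≤ suc a → (if a <ᵇ b then 1 else 0) + a ≡ b
unit-step {a} {b} a≤b b≤1+a with a <ᵇ b | ℕ.<ᵇ-reflects-< a b
... | true  | ofʸ a<b = ℕ.≤-antisym a<b b≤1+a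
... | false | ofⁿ a≮b = ℕ.≤-antisym a≤b (ℕ.≮⇒≥ a≮b)

eℕ-fromPath : ∀ {n h} → IsPath 1 n h → (j : Fin n) → eℕ (fromPath h) j + h (suc (toℕ j)) ≡ h (toℕ j)
eℕ-fromPath p fzero    = unit-step (antitone p 0) (step≤ p 0)
eℕ-fromPath p (fsuc j) = eℕ-fromPath (IsPath-tail p) j

count≥-fromPath : ∀ {n h} → IsPath 1 n h → ∀ t → count≥ (fromPath {n} h) t ≡ h t
count≥-fromPath {zero}      p t       = sym (vanishes p z≤n)
count≥-fromPath {suc n} {h} p zero    = begin
  eℕ (fromPath {suc n} h) fzero + count≥ (fromPath {n} (h ∘ suc)) 0
    ≡⟨ cong (_ +_) (count≥-fromPath (IsPath-tail p) 0) ⟩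
  eℕ (fromPath {suc n} h) fzero + h 1
    ≡⟨ eℕ-fromPath p fzero ⟩
  h 0
    ∎
  where open ≡-Reasoning
count≥-fromPath {suc n}     p (suc t) = count≥-fromPath (IsPath-tail p) t

_∨G_ : ∀ {n} → Subset n → Subset n → Subset n
A ∨G B = fromPath (λ t → count≥ A t ⊔ count≥ B t)

_∧G_ : ∀ {n} → Subset n → Subset n → Subset n
A ∧G B = fromPath (λ t → count≥ A t ⊓ count≥ B t)

count≥-∨G : ∀ {n} (A B : Subset n) t → count≥ (A ∨G B) t ≡ count≥ A t ⊔ count≥ B t
count≥-∨G A B = count≥-fromPath (⊔-isPath (count≥-isPath A) (count≥-isPath B))

count≥-∧G : ∀ {n} (A B : Subset n) t → count≥ (A ∧G B) t ≡ count≥ A t ⊓ count≥ B t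
count≥-∧G A B = count≥-fromPath (⊓-isPath (count≥-isPath A) (count≥-isPath B))

-- Hermite's identity and rounding

[n+m]/n≡1+m/n : ∀ m n .{{_ : NonZero n}} → (n + m) / n ≡ suc (m / n)
[n+m]/n≡1+m/n m n = trans (+-distrib-/-∣ˡ m (∣-refl {n})) (cong (_+ m / n) (n/n≡1 n))

≤[m+k]/n : ∀ {a m} k n .{{_ : NonZero n}} → n * a ≤ m → a ≤ (m + k) / n
≤[m+k]/n {a} {m} k n n*a≤m = begin
  a             ≡⟨ m*n/n≡m a n ⟨
  a * n / n     ≡⟨ cong (_/ n) (ℕ.*-comm a n) ⟩
  n * a / n     ≤⟨ /-monoˡ-≤ n (ℕ.≤-trans n*a≤m (ℕ.m≤m+n m k)) ⟩
  (m + k) / n   ∎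
  where open ℕ.≤-Reasoning

[m+k]/n≤ : ∀ {a m k} n .{{_ : NonZero n}} → m ≤ n * a → k < n → (m + k) / n ≤ a
[m+k]/n≤ {a} {m} {k} n m≤n*a k<n = ℕ.≤-pred (m<n*o⇒m/o<n (begin-strict
  m + k       <⟨ ℕ.+-monoʳ-< m k<n ⟩
  m + n       ≤⟨ ℕ.+-monoˡ-≤ n m≤n*a ⟩
  n * a + n   ≡⟨ ℕ.+-comm (n * a) n ⟩
  n + n * a   ≡⟨ cong (_+_ n) (ℕ.*-comm n a) ⟩
  suc a * n   ∎))
  where open ℕ.≤-Reasoning

∑-last : ∀ N (g : ℕ → ℕ) → ∑[ k < suc N ] g (toℕ k) ≡ ∑[ k < N ] g (toℕ k) + g N
∑-last N g = trans (sum-init-last (g ∘ toℕ))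
  (cong₂ _+_ (sum-cong-≗ {N} (cong g ∘ FP.toℕ-inject₁)) (cong g (FP.toℕ-fromℕ N)))

-- Shifting k by one trades the term ⌊m/N⌋ for ⌊(m + N)/N⌋ = ⌊m/N⌋ + 1.
hermite-identity : ∀ N .{{_ : NonZero N}} m → ∑[ k < N ] ((m + toℕ k) / N) ≡ m
hermite-identity N zero    = trans (sum-cong-≗ {N} (λ k → m<n⇒m/n≡0 (FP.toℕ<n k))) (sum-replicate-zero N)
hermite-identity N (suc m) = ℕ.+-cancelˡ-≡ (m / N) _ _ (begin
  m / N + ∑[ k < N ] ((suc m + toℕ k) / N)
    ≡⟨ cong₂ _+_ (cong (_/ N) (sym (ℕ.+-identityʳ m))) shift-suc ⟩
  ∑[ k < suc N ] ((m + toℕ k) / N)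
    ≡⟨ ∑-last N (λ k → (m + k) / N) ⟩
  ∑[ k < N ] ((m + toℕ k) / N) + (m + N) / N
    ≡⟨ cong₂ _+_ (hermite-identity N m) (trans (cong (_/ N) (ℕ.+-comm m N)) ([n+m]/n≡1+m/n m N)) ⟩
  m + suc (m / N)
    ≡⟨ trans (ℕ.+-suc m (m / N)) (cong suc (ℕ.+-comm m (m / N))) ⟩
  suc (m / N + m)
    ≡⟨ ℕ.+-suc (m / N) m ⟨
  m / N + suc m
    ∎)
  where
  open ≡-Reasoning
  shift-suc : ∑[ k < N ] ((suc m + toℕ k) / N) ≡ ∑[ k < N ] ((m + suc (toℕ k)) / N)
  shift-suc = sum-cong-≗ {N} (λ k → cong (_/ N) (sym (ℕ.+-suc m (toℕ k))))

module Rounding {N n : ℕ} .{{_ : NonZero N}} {Y : ℕ → ℕ} (Y-path : IsPath N n Y) where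

  round : Fin N → ℕ → ℕ
  round k t = (Y t + toℕ k) / N

  round-isPath : ∀ k → IsPath 1 n (round k)
  round-isPath k = record
    { vanishes = λ n≤t → trans (cong (λ y → (y + toℕ k) / N) (vanishes Y-path n≤t))
                               (m<n⇒m/n≡0 (FP.toℕ<n k))
    ; antitone = λ t → /-monoˡ-≤ N (ℕ.+-monoˡ-≤ (toℕ k) (antitone Y-path t))
    ; step≤    = λ t → ℕ.≤-trans (/-monoˡ-≤ N (ℕ.+-monoˡ-≤ (toℕ k) (step≤ Y-path t)))
                         (ℕ.≤-reflexive (trans (cong (_/ N) (ℕ.+-assoc N _ (toℕ k))) ([n+m]/n≡1+m/n _ N)))
    }

  ∑-eℕ-round : ∀ j → ∑[ k < N ] eℕ (fromPath (round k)) j + Y (suc (toℕ j)) ≡ Y (toℕ j)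
  ∑-eℕ-round j = begin
    ∑[ k < N ] eℕ (fromPath (round k)) j + Y (suc t)
      ≡⟨ cong ((∑[ k < N ] eℕ (fromPath (round k)) j) +_) (hermite-identity N (Y (suc t))) ⟨
    ∑[ k < N ] eℕ (fromPath (round k)) j + ∑[ k < N ] round k (suc t)
      ≡⟨ ∑-distrib-+ (λ k → eℕ (fromPath (round k)) j) (λ k → round k (suc t)) ⟨
    ∑[ k < N ] (eℕ (fromPath (round k)) j + round k (suc t))
      ≡⟨ sum-cong-≗ {N} (λ k → eℕ-fromPath (round-isPath k) j) ⟩
    ∑[ k < N ] round k t
      ≡⟨ hermite-identity N (Y t) ⟩
    Y t
      ∎
    where
    t : ℕ
    t = toℕ j
    open ≡-Reasoning

-- Rational points and convex combinations

ι : ℕ → ℚ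
ι k = fromℤ (ℤ.+ k)

ι-+ : ∀ a b → ι (a + b) ≡ ι a +ℚ ι b
ι-+ a b = ℚ.toℚᵘ-injective (ℚᵘ.≃-sym (ℚᵘ.≃-trans (ℚ.toℚᵘ-homo-+ (ι a) (ι b)) (ℚᵘ.*≡* eq)))
  where
  eq : (ℤ.+ a ℤ.* ℤ.+ 1 ℤ.+ ℤ.+ b ℤ.* ℤ.+ 1) ℤ.* ℤ.+ 1 ≡ ℤ.+ (a + b) ℤ.* ℤ.+ 1
  eq = trans (ℤ.*-identityʳ _) (trans (cong₂ ℤ._+_ (ℤ.*-identityʳ (ℤ.+ a)) (ℤ.*-identityʳ (ℤ.+ b)))
         (trans (sym (ℤ.pos-+ a b)) (sym (ℤ.*-identityʳ _))))

ι-* : ∀ a b → ι (a * b) ≡ ι a *ℚ ι b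
ι-* a b = ℚ.toℚᵘ-injective (ℚᵘ.≃-sym (ℚᵘ.≃-trans (ℚ.toℚᵘ-homo-* (ι a) (ι b)) (ℚᵘ.*≡* eq)))
  where
  eq : (ℤ.+ a ℤ.* ℤ.+ b) ℤ.* ℤ.+ 1 ≡ ℤ.+ (a * b) ℤ.* ℤ.+ 1
  eq = cong (ℤ._* ℤ.+ 1) (sym (ℤ.pos-* a b))

ι-mono-≤ : ∀ {a b} → a ≤ b → ι a ≤ℚ ι b
ι-mono-≤ {a} {b} a≤b =
  *≤* (subst₂ ℤ._≤_ (sym (ℤ.*-identityʳ (ℤ.+ a))) (sym (ℤ.*-identityʳ (ℤ.+ b))) (ℤ.+≤+ a≤b))

ι-cancel-≤ : ∀ {a b} → ι a ≤ℚ ι b → a ≤ b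
ι-cancel-≤ {a} {b} ιa≤ιb =
  ℤ.drop‿+≤+ (subst₂ ℤ._≤_ (ℤ.*-identityʳ (ℤ.+ a)) (ℤ.*-identityʳ (ℤ.+ b)) (ℚ.drop-*≤* ιa≤ιb))

ι-⊔-lub : ∀ {a b y} → ι a ≤ℚ y → ι b ≤ℚ y → ι (a ⊔ b) ≤ℚ y
ι-⊔-lub {a} {b} ιa≤y ιb≤y with ℕ.⊔-sel a b
... | inj₁ a⊔b≡a rewrite a⊔b≡a = ιa≤y
... | inj₂ a⊔b≡b rewrite a⊔b≡b = ιb≤y

ι-⊓-glb : ∀ {a b y} → y ≤ℚ ι a → y ≤ℚ ι b → y ≤ℚ ι (a ⊓ b)
ι-⊓-glb {a} {b} y≤ιa y≤ιb with ℕ.⊓-sel a b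
... | inj₁ a⊓b≡a rewrite a⊓b≡a = y≤ιa
... | inj₂ a⊓b≡b rewrite a⊓b≡b = y≤ιb

e≡ι∘eℕ : ∀ {n} (A : Subset n) j → e A j ≡ ι (eℕ A j)
e≡ι∘eℕ A j with lookup A j
... | inside  = refl
... | outside = refl

e-unit : ∀ {n} (A : Subset n) j → 0ℚ ≤ℚ e A j × e A j ≤ℚ 1ℚ
e-unit A j with lookup A j
... | inside  = ℚ.nonNegative⁻¹ 1ℚ , ℚ.≤-refl
... | outside = ℚ.≤-refl , ℚ.nonNegative⁻¹ 1ℚ

denominator*≡numerator : ∀ q → 0ℚ ≤ℚ q → ι (ℚ.↧ₙ q) *ℚ q ≡ ι ℤ.∣ ℚ.↥ q ∣
denominator*≡numerator q@(mkℚ (ℤ.+ m) d _) _ =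
  ℚ.toℚᵘ-injective (ℚᵘ.≃-trans (ℚ.toℚᵘ-homo-* (ι (suc d)) q) (ℚᵘ.*≡* eq))
  where
  eq : (ℤ.+ suc d ℤ.* ℤ.+ m) ℤ.* ℤ.+ 1 ≡ ℤ.+ m ℤ.* ℤ.+ suc (d + 0)
  eq = trans (ℤ.*-identityʳ _) (trans (ℤ.*-comm (ℤ.+ suc d) (ℤ.+ m))
         (cong (λ k → ℤ.+ m ℤ.* ℤ.+ suc k) (sym (ℕ.+-identityʳ d))))
denominator*≡numerator (mkℚ -[1+ _ ] _ _) (*≤* ())

commonDenominator : ∀ {n} (x : Point n) → (∀ j → 0ℚ ≤ℚ x j) →
  Σ ℕ λ d → Σ (Fin n → ℕ) λ X → ∀ j → ι (X j) ≡ ι (suc d) *ℚ x j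
commonDenominator {zero}  x _   = 0 , (λ ()) , (λ ())
commonDenominator {suc n} x x≥0 with commonDenominator (x ∘ fsuc) (x≥0 ∘ fsuc)
... | d , X , X≡ = _ , X′ , X′≡
  where
  open +-*-Solver
  open ≡-Reasoning
  N q : ℕ
  N = suc d
  q = ℚ.↧ₙ (x fzero)
  X′ : Fin (suc n) → ℕ
  X′ fzero    = N * ℤ.∣ ℚ.↥ x fzero ∣
  X′ (fsuc j) = X j * q
  X′≡ : ∀ j → ι (X′ j) ≡ ι (N * q) *ℚ x j
  X′≡ fzero = begin
    ι (N * ℤ.∣ ℚ.↥ x fzero ∣)     ≡⟨ ι-* N _ ⟩
    ι N *ℚ ι ℤ.∣ ℚ.↥ x fzero ∣    ≡⟨ cong (ι N *ℚ_) (denominator*≡numerator (x fzero) (x≥0 fzero)) ⟨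
    ι N *ℚ (ι q *ℚ x fzero)       ≡⟨ ℚ.*-assoc (ι N) (ι q) (x fzero) ⟨
    (ι N *ℚ ι q) *ℚ x fzero       ≡⟨ cong (_*ℚ x fzero) (ι-* N q) ⟨
    ι (N * q) *ℚ x fzero          ∎
  X′≡ (fsuc j) = begin
    ι (X j * q)                   ≡⟨ ι-* (X j) q ⟩
    ι (X j) *ℚ ι q                ≡⟨ cong (_*ℚ ι q) (X≡ j) ⟩
    (ι N *ℚ x (fsuc j)) *ℚ ι q    ≡⟨ solve 3 (λ a b c → (a :* b) :* c := (a :* c) :* b) refl (ι N) (x (fsuc j)) (ι q) ⟩
    (ι N *ℚ ι q) *ℚ x (fsuc j)    ≡⟨ cong (_*ℚ x (fsuc j)) (ι-* N q) ⟨
    ι (N * q) *ℚ x (fsuc j)       ∎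

Σ≥ℚ : ∀ {n} → Point n → ℕ → ℚ
Σ≥ℚ = suffixSum _+ℚ_ 0ℚ

ι-Σ≥ : ∀ {n} (X : Fin n → ℕ) t → ι (Σ≥ X t) ≡ Σ≥ℚ (ι ∘ X) t
ι-Σ≥ = suffixSum-homo ι refl ι-+

*-Σ≥ℚ : ∀ {n} c (x : Point n) t → c *ℚ Σ≥ℚ x t ≡ Σ≥ℚ (λ j → c *ℚ x j) t
*-Σ≥ℚ c = suffixSum-homo (c *ℚ_) (ℚ.*-zeroʳ c) (ℚ.*-distribˡ-+ c)

Σ≥ℚ-zero : ∀ {n} t → Σ≥ℚ {n} (λ _ → 0ℚ) t ≡ 0ℚ
Σ≥ℚ-zero {zero}  t       = refl
Σ≥ℚ-zero {suc n} zero    = cong (0ℚ +ℚ_) (Σ≥ℚ-zero {n} zero)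
Σ≥ℚ-zero {suc n} (suc t) = Σ≥ℚ-zero {n} t

Σ≥ℚ-+ : ∀ {n} (x y : Point n) t → Σ≥ℚ (λ j → x j +ℚ y j) t ≡ Σ≥ℚ x t +ℚ Σ≥ℚ y t
Σ≥ℚ-+ {zero}  x y t       = refl
Σ≥ℚ-+ {suc n} x y zero    = begin
  (x fzero +ℚ y fzero) +ℚ Σ≥ℚ (λ j → x (fsuc j) +ℚ y (fsuc j)) 0
    ≡⟨ cong ((x fzero +ℚ y fzero) +ℚ_) (Σ≥ℚ-+ (x ∘ fsuc) (y ∘ fsuc) 0) ⟩
  (x fzero +ℚ y fzero) +ℚ (Σ≥ℚ (x ∘ fsuc) 0 +ℚ Σ≥ℚ (y ∘ fsuc) 0)
    ≡⟨ interchange (x fzero) (y fzero) (Σ≥ℚ (x ∘ fsuc) 0) (Σ≥ℚ (y ∘ fsuc) 0) ⟩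
  (x fzero +ℚ Σ≥ℚ (x ∘ fsuc) 0) +ℚ (y fzero +ℚ Σ≥ℚ (y ∘ fsuc) 0)
    ∎
  where
  open ≡-Reasoning
  open +-*-Solver
  interchange : ∀ a b c d → (a +ℚ b) +ℚ (c +ℚ d) ≡ (a +ℚ c) +ℚ (b +ℚ d)
  interchange = solve 4 (λ a b c d → (a :+ b) :+ (c :+ d) := (a :+ c) :+ (b :+ d)) refl
Σ≥ℚ-+ {suc n} x y (suc t) = Σ≥ℚ-+ (x ∘ fsuc) (y ∘ fsuc) t

Σ≥ℚ-e : ∀ {n} (A : Subset n) t → Σ≥ℚ (e A) t ≡ ι (count≥ A t)
Σ≥ℚ-e A t = trans (suffixSum-cong (e≡ι∘eℕ A) t) (sym (ι-Σ≥ (eℕ A) t))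

weight : ∀ {A : Set} → List (ℚ × A) → ℚ
weight L = sumℚ (map proj₁ L)

wsum : ∀ {A : Set} → List (ℚ × A) → (A → ℚ) → ℚ
wsum L f = sumℚ (map (λ cR → proj₁ cR *ℚ f (proj₂ cR)) L)

wsum-cong : ∀ {A : Set} (L : List (ℚ × A)) {f g : A → ℚ} → (∀ a → f a ≡ g a) → wsum L f ≡ wsum L g
wsum-cong L f≡g = cong sumℚ (LP.map-cong (λ cR → cong (proj₁ cR *ℚ_) (f≡g (proj₂ cR))) L)

Σ≥ℚ-wsum : ∀ {A : Set} {n} (L : List (ℚ × A)) (g : A → Point n) t →
  Σ≥ℚ (λ j → wsum L (λ a → g a j)) t ≡ wsum L (λ a → Σ≥ℚ (g a) t)
Σ≥ℚ-wsum {n = n} []  g t = Σ≥ℚ-zero {n} t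
Σ≥ℚ-wsum ((c , a) ∷ L) g t = begin
  Σ≥ℚ (λ j → c *ℚ g a j +ℚ wsum L (λ a → g a j)) t
    ≡⟨ Σ≥ℚ-+ (λ j → c *ℚ g a j) (λ j → wsum L (λ a → g a j)) t ⟩
  Σ≥ℚ (λ j → c *ℚ g a j) t +ℚ Σ≥ℚ (λ j → wsum L (λ a → g a j)) t
    ≡⟨ cong₂ _+ℚ_ (sym (*-Σ≥ℚ c (g a) t)) (Σ≥ℚ-wsum L g t) ⟩
  c *ℚ Σ≥ℚ (g a) t +ℚ wsum L (λ a → Σ≥ℚ (g a) t)
    ∎
  where open ≡-Reasoning

Weighted : ∀ {A : Set} → (A → Set) → List (ℚ × A) → Set
Weighted Q = All (λ cR → 0ℚ ≤ℚ proj₁ cR × Q (proj₂ cR))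

module _ {A : Set} {Q : A → Set} (f : A → ℚ) {lo hi : ℚ}
         (bounded : ∀ {a} → Q a → lo ≤ℚ f a × f a ≤ℚ hi) where

  private
    lower : (L : List (ℚ × A)) → Weighted Q L → lo *ℚ weight L ≤ℚ wsum L f
    lower []            []                    = ℚ.≤-reflexive (ℚ.*-zeroʳ lo)
    lower ((c , a) ∷ L) ((c≥0 , Qa) ∷ L-ok) = begin
      lo *ℚ (c +ℚ weight L)       ≡⟨ ℚ.*-distribˡ-+ lo c (weight L) ⟩
      lo *ℚ c +ℚ lo *ℚ weight L   ≡⟨ cong (_+ℚ lo *ℚ weight L) (ℚ.*-comm lo c) ⟩
      c *ℚ lo +ℚ lo *ℚ weight L   ≤⟨ ℚ.+-mono-≤ (ℚ.*-monoˡ-≤-nonNeg c {{ℚ.nonNegative c≥0}} (proj₁ (bounded Qa)))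
                                                (lower L L-ok) ⟩
      c *ℚ f a +ℚ wsum L f        ∎
      where open ℚ.≤-Reasoning

    upper : (L : List (ℚ × A)) → Weighted Q L → wsum L f ≤ℚ hi *ℚ weight L
    upper []            []                    = ℚ.≤-reflexive (sym (ℚ.*-zeroʳ hi))
    upper ((c , a) ∷ L) ((c≥0 , Qa) ∷ L-ok) = begin
      c *ℚ f a +ℚ wsum L f        ≤⟨ ℚ.+-mono-≤ (ℚ.*-monoˡ-≤-nonNeg c {{ℚ.nonNegative c≥0}} (proj₂ (bounded Qa)))
                                                (upper L L-ok) ⟩
      c *ℚ hi +ℚ hi *ℚ weight L   ≡⟨ cong (_+ℚ hi *ℚ weight L) (ℚ.*-comm c hi) ⟩
      hi *ℚ c +ℚ hi *ℚ weight L   ≡⟨ ℚ.*-distribˡ-+ hi c (weight L) ⟨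
      hi *ℚ (c +ℚ weight L)       ∎
      where open ℚ.≤-Reasoning

  convex-bounded : (L : List (ℚ × A)) → Weighted Q L → weight L ≡ 1ℚ → lo ≤ℚ wsum L f × wsum L f ≤ℚ hi
  convex-bounded L L-ok total =
    subst (_≤ℚ wsum L f) (trans (cong (lo *ℚ_) total) (ℚ.*-identityʳ lo)) (lower L L-ok) ,
    subst (wsum L f ≤ℚ_) (trans (cong (hi *ℚ_) total) (ℚ.*-identityʳ hi)) (upper L L-ok)

sumℚ-tabulate-ι : ∀ {N} (c : ℚ) (f : Fin N → ℕ) →
  sumℚ (tabulate (λ k → c *ℚ ι (f k))) ≡ c *ℚ ι (∑[ k < N ] f k)
sumℚ-tabulate-ι {zero}  c f = sym (ℚ.*-zeroʳ c)
sumℚ-tabulate-ι {suc N} c f = begin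
  c *ℚ ι (f fzero) +ℚ sumℚ (tabulate (λ k → c *ℚ ι (f (fsuc k))))
    ≡⟨ cong (c *ℚ ι (f fzero) +ℚ_) (sumℚ-tabulate-ι c (f ∘ fsuc)) ⟩
  c *ℚ ι (f fzero) +ℚ c *ℚ ι (∑[ k < N ] f (fsuc k))
    ≡⟨ ℚ.*-distribˡ-+ c _ _ ⟨
  c *ℚ (ι (f fzero) +ℚ ι (∑[ k < N ] f (fsuc k)))
    ≡⟨ cong (c *ℚ_) (ι-+ (f fzero) _) ⟨
  c *ℚ ι (∑[ k < suc N ] f k)
    ∎
  where open ≡-Reasoning

∑-one : ∀ N → ∑[ k < N ] 1 ≡ N
∑-one zero    = refl
∑-one (suc N) = cong suc (∑-one N)

average∈InConv : ∀ {n} {F : Subset n → Set} d (R : Fin (suc d) → Subset n) → (∀ k → F (R k)) →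
  (x : Point n) → (∀ j → ι (∑[ k < suc d ] eℕ (R k) j) ≡ ι (suc d) *ℚ x j) → InConv F x
average∈InConv {n} d R R-ok x column = L , All.tabulate⁺ (λ k → ℚ.nonNegative⁻¹ w , R-ok k) , total , coords
  where
  open ≡-Reasoning
  N : ℕ
  N = suc d
  w : ℚ
  w = 1/ ι N
  L : List (ℚ × Subset n)
  L = tabulate (λ k → w , R k)
  total : weight L ≡ 1ℚ
  total = begin
    sumℚ (map proj₁ L)                         ≡⟨ cong sumℚ (LP.map-tabulate (λ k → w , R k) proj₁) ⟩
    sumℚ (tabulate {n = N} (λ _ → w))          ≡⟨ cong sumℚ (LP.tabulate-cong {n = N} (λ _ → ℚ.*-identityʳ w)) ⟨
    sumℚ (tabulate {n = N} (λ _ → w *ℚ ι 1))   ≡⟨ sumℚ-tabulate-ι {N} w (λ _ → 1) ⟩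
    w *ℚ ι (∑[ k < N ] 1)                      ≡⟨ cong (λ m → w *ℚ ι m) (∑-one N) ⟩
    w *ℚ ι N                                   ≡⟨ ℚ.*-inverseˡ (ι N) ⟩
    1ℚ                                         ∎
  coords : ∀ j → x j ≡ wsum L (λ R → e R j)
  coords j = sym (begin
    wsum L (λ R → e R j)
      ≡⟨ cong sumℚ (LP.map-tabulate (λ k → w , R k) (λ cR → proj₁ cR *ℚ e (proj₂ cR) j)) ⟩
    sumℚ (tabulate (λ k → w *ℚ e (R k) j))
      ≡⟨ cong sumℚ (LP.tabulate-cong (λ k → cong (w *ℚ_) (e≡ι∘eℕ (R k) j))) ⟩
    sumℚ (tabulate (λ k → w *ℚ ι (eℕ (R k) j)))
      ≡⟨ sumℚ-tabulate-ι {N} w (λ k → eℕ (R k) j) ⟩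
    w *ℚ ι (∑[ k < N ] eℕ (R k) j)
      ≡⟨ cong (w *ℚ_) (column j) ⟩
    w *ℚ (ι N *ℚ x j)
      ≡⟨ ℚ.*-assoc w (ι N) (x j) ⟨
    (w *ℚ ι N) *ℚ x j
      ≡⟨ cong (_*ℚ x j) (ℚ.*-inverseˡ (ι N)) ⟩
    1ℚ *ℚ x j
      ≡⟨ ℚ.*-identityˡ (x j) ⟩
    x j
      ∎)

-- The polytope P(Δ[C,D])

InUnitCube : ∀ {n} → Point n → Set
InUnitCube x = ∀ j → 0ℚ ≤ℚ x j × x j ≤ℚ 1ℚ

record TailBounded {n} (C D : Subset n) (x : Point n) : Set where
  field
    lower : ∀ t → ι (count≥ C t) ≤ℚ Σ≥ℚ x t
    upper : ∀ t → Σ≥ℚ x t ≤ℚ ι (count≥ D t)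

open TailBounded

InConv⇒InUnitCube : ∀ {n} {F : Subset n → Set} {x} → InConv F x → InUnitCube x
InConv⇒InUnitCube (L , L-ok , total , x≡) j =
  subst (λ y → 0ℚ ≤ℚ y × y ≤ℚ 1ℚ) (sym (x≡ j))
    (convex-bounded (λ R → e R j) (λ {R} _ → e-unit R j) L L-ok total)

P⇒TailBounded : ∀ {n} {C D : Subset n} {x} → P C D x → TailBounded C D x
P⇒TailBounded {C = C} {D} {x} (L , L-ok , total , x≡) = record
  { lower = λ t → proj₁ (bounded t)
  ; upper = λ t → proj₂ (bounded t)
  }
  where
  Σ≥ℚ-x : ∀ t → Σ≥ℚ x t ≡ wsum L (λ R → ι (count≥ R t))
  Σ≥ℚ-x t = begin
    Σ≥ℚ x t                               ≡⟨ suffixSum-cong x≡ t ⟩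
    Σ≥ℚ (λ j → wsum L (λ R → e R j)) t    ≡⟨ Σ≥ℚ-wsum L e t ⟩
    wsum L (λ R → Σ≥ℚ (e R) t)            ≡⟨ wsum-cong L (λ R → Σ≥ℚ-e R t) ⟩
    wsum L (λ R → ι (count≥ R t))         ∎
    where open ≡-Reasoning
  feasible-bounded : ∀ t {R} → Feasible C D R →
    ι (count≥ C t) ≤ℚ ι (count≥ R t) × ι (count≥ R t) ≤ℚ ι (count≥ D t)
  feasible-bounded t (C≤R , R≤D) = ι-mono-≤ (≤G⇒count≥-≤ C≤R t) , ι-mono-≤ (≤G⇒count≥-≤ R≤D t)
  bounded : ∀ t → ι (count≥ C t) ≤ℚ Σ≥ℚ x t × Σ≥ℚ x t ≤ℚ ι (count≥ D t)
  bounded t = subst (λ y → ι (count≥ C t) ≤ℚ y × y ≤ℚ ι (count≥ D t)) (sym (Σ≥ℚ-x t))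
    (convex-bounded (λ R → ι (count≥ R t)) (feasible-bounded t) L L-ok total)

scale-InUnitCube : ∀ {n} {x : Point n} N (X : Fin n → ℕ) → (∀ j → ι (X j) ≡ ι N *ℚ x j) →
  InUnitCube x → ∀ j → X j ≤ N
scale-InUnitCube {x = x} N X X≡ cube j = ι-cancel-≤ (begin
  ι (X j)       ≡⟨ X≡ j ⟩
  ι N *ℚ x j    ≤⟨ ℚ.*-monoˡ-≤-nonNeg (ι N) (proj₂ (cube j)) ⟩
  ι N *ℚ 1ℚ     ≡⟨ ℚ.*-identityʳ (ι N) ⟩
  ι N           ∎)
  where open ℚ.≤-Reasoning

scale-TailBounded : ∀ {n} {C D : Subset n} {x} N (X : Fin n → ℕ) → (∀ j → ι (X j) ≡ ι N *ℚ x j) →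
  TailBounded C D x → ∀ t → N * count≥ C t ≤ Σ≥ X t × Σ≥ X t ≤ N * count≥ D t
scale-TailBounded {C = C} {D} {x} N X X≡ bounds t = ι-cancel-≤ N*C≤Y , ι-cancel-≤ Y≤N*D
  where
  open ℚ.≤-Reasoning
  ιY : ι (Σ≥ X t) ≡ ι N *ℚ Σ≥ℚ x t
  ιY = trans (ι-Σ≥ X t) (trans (suffixSum-cong X≡ t) (sym (*-Σ≥ℚ (ι N) x t)))
  N*C≤Y : ι (N * count≥ C t) ≤ℚ ι (Σ≥ X t)
  N*C≤Y = begin
    ι (N * count≥ C t)      ≡⟨ ι-* N (count≥ C t) ⟩
    ι N *ℚ ι (count≥ C t)   ≤⟨ ℚ.*-monoˡ-≤-nonNeg (ι N) (lower bounds t) ⟩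
    ι N *ℚ Σ≥ℚ x t          ≡⟨ ιY ⟨
    ι (Σ≥ X t)              ∎
  Y≤N*D : ι (Σ≥ X t) ≤ℚ ι (N * count≥ D t)
  Y≤N*D = begin
    ι (Σ≥ X t)              ≡⟨ ιY ⟩
    ι N *ℚ Σ≥ℚ x t          ≤⟨ ℚ.*-monoˡ-≤-nonNeg (ι N) (upper bounds t) ⟩
    ι N *ℚ ι (count≥ D t)   ≡⟨ ι-* N (count≥ D t) ⟨
    ι (N * count≥ D t)      ∎

InUnitCube×TailBounded⇒P : ∀ {n} {C D : Subset n} {x} → InUnitCube x → TailBounded C D x → P C D x
InUnitCube×TailBounded⇒P {n} {C} {D} {x} cube bounds with commonDenominator x (proj₁ ∘ cube)
... | d , X , X≡ = average∈InConv d R R-feasible x column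
  where
  N : ℕ
  N = suc d

  open Rounding (Σ≥-isPath X (scale-InUnitCube N X X≡ cube))

  R : Fin N → Subset n
  R k = fromPath (round k)

  R-feasible : ∀ k → Feasible C D (R k)
  R-feasible k =
    count≥-≤⇒≤G (λ t → subst (count≥ C t ≤_) (sym (count≥-fromPath (round-isPath k) t))
      (≤[m+k]/n (toℕ k) N (proj₁ (scale-TailBounded N X X≡ bounds t)))) ,
    count≥-≤⇒≤G (λ t → subst (_≤ count≥ D t) (sym (count≥-fromPath (round-isPath k) t))
      ([m+k]/n≤ N (proj₂ (scale-TailBounded N X X≡ bounds t)) (FP.toℕ<n k)))

  column : ∀ j → ι (∑[ k < N ] eℕ (R k) j) ≡ ι N *ℚ x j
  column j = trans (cong ι (ℕ.+-cancelʳ-≡ _ _ _ (trans (∑-eℕ-round j) (suffixSum-split X j)))) (X≡ j)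

TailBounded-mono : ∀ {n} {C C′ D D′ : Subset n} {x} →
  (∀ t → count≥ C′ t ≤ count≥ C t) → (∀ t → count≥ D t ≤ count≥ D′ t) →
  TailBounded C D x → TailBounded C′ D′ x
TailBounded-mono C′≤C D≤D′ bounds = record
  { lower = λ t → ℚ.≤-trans (ι-mono-≤ (C′≤C t)) (lower bounds t)
  ; upper = λ t → ℚ.≤-trans (upper bounds t) (ι-mono-≤ (D≤D′ t))
  }

TailBounded-∩⁺ : ∀ {n} {S T S′ T′ : Subset n} {x} → TailBounded S T x → TailBounded S′ T′ x →
  TailBounded (S ∨G S′) (T ∧G T′) x
TailBounded-∩⁺ {S = S} {T} {S′} {T′} {x} bounds bounds′ = record
  { lower = λ t → subst (_≤ℚ Σ≥ℚ x t) (cong ι (sym (count≥-∨G S S′ t)))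
                        (ι-⊔-lub (lower bounds t) (lower bounds′ t))
  ; upper = λ t → subst (Σ≥ℚ x t ≤ℚ_) (cong ι (sym (count≥-∧G T T′ t)))
                        (ι-⊓-glb (upper bounds t) (upper bounds′ t))
  }

TailBounded-∩⁻ : ∀ {n} {S T S′ T′ : Subset n} {x} → TailBounded (S ∨G S′) (T ∧G T′) x →
  TailBounded S T x × TailBounded S′ T′ x
TailBounded-∩⁻ {S = S} {T} {S′} {T′} bounds =
  TailBounded-mono (λ t → ∨G-≥ t (ℕ.m≤m⊔n _ _)) (λ t → ∧G-≤ t (ℕ.m⊓n≤m _ _)) bounds ,
  TailBounded-mono (λ t → ∨G-≥ t (ℕ.m≤n⊔m _ _)) (λ t → ∧G-≤ t (ℕ.m⊓n≤n _ _)) bounds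
  where
  ∨G-≥ : ∀ {a} t → a ≤ count≥ S t ⊔ count≥ S′ t → a ≤ count≥ (S ∨G S′) t
  ∨G-≥ t = subst (_ ≤_) (sym (count≥-∨G S S′ t))
  ∧G-≤ : ∀ {a} t → count≥ T t ⊓ count≥ T′ t ≤ a → count≥ (T ∧G T′) t ≤ a
  ∧G-≤ t = subst (_≤ _) (sym (count≥-∧G T T′ t))

P-∩ : ∀ {n} {S T S′ T′ : Subset n} {x} → (P S T x × P S′ T′ x) ⇔ P (S ∨G S′) (T ∧G T′) x
P-∩ = mk⇔
  (λ (p , p′) → InUnitCube×TailBounded⇒P (InConv⇒InUnitCube p)
                   (TailBounded-∩⁺ (P⇒TailBounded p) (P⇒TailBounded p′)))
  (λ p → let bounds , bounds′ = TailBounded-∩⁻ (P⇒TailBounded p) in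
    InUnitCube×TailBounded⇒P (InConv⇒InUnitCube p) bounds ,
    InUnitCube×TailBounded⇒P (InConv⇒InUnitCube p) bounds′)

P⇒≤G : ∀ {n} {C D : Subset n} {x} → P C D x → C ≤G D
P⇒≤G {C = C} {D} {x} p = count≥-≤⇒≤G (λ t → ι-cancel-≤ (ℚ.≤-trans (lower bounds t) (upper bounds t)))
  where
  bounds : TailBounded C D x
  bounds = P⇒TailBounded p

proposition4p6 : (n : ℕ) (S T S′ T′ : Subset n) → S ≤G T → S′ ≤G T′ →
    ((x : Point n) → ¬ (P S T x × P S′ T′ x))
    ⊎ Σ (Subset n) (λ C → Σ (Subset n) (λ D → (C ≤G D)
        × ((x : Point n) → (P S T x × P S′ T′ x) ⇔ P C D x)))
proposition4p6 n S T S′ T′ _ _ with (S ∨G S′) ≤G? (T ∧G T′)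
... | yes C≤D = inj₂ (S ∨G S′ , T ∧G T′ , C≤D , λ x → P-∩)
... | no C≰D  = inj₁ (λ x x∈∩ → C≰D (P⇒≤G (Equivalence.to P-∩ x∈∩)))
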